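{- Let $n\ge 1$ and $k\ge 1$ be integers and let $S_1,S_2,\ldots,S_k$ be nonempty finite sets of positive integers such that $\sum_{i=1}^k \max S_i = n$. Then there is a unique cyclic ternary word of length $n$ (over $\{0,x,y\}$, with at least one $x$, considered up to rotation) whose sets of spacings are exactly $S_1,\ldots,S_k$, arranged so that for each $1\le i\le k-1$, if $S_i$ is the set of spacings associated with a given anchor point, then $S_{i+1}$ is the set of spacings associated with the following anchor point (the next anchor point in cyclic order).
   Context: A cyclic ternary word of length $n$ is a word $w_1w_2\cdots w_n$ over the alphabet $\{0,x,y\}$ containing at least one $x$, with positions read cyclically (indices modulo $n$). An entry is nonzero if it is $x$ or $y$. A position $j$ is an anchor point if $w_j$ is nonzero and the nearest nonzero entry strictly preceding $j$ cyclically (i.e. $w_{j-d}$ for the least $d\in\{1,\ldots,n\}$ with $w_{j-d}$ nonzero; this may be $j$ itself when $d=n$) is an $x$; in words, an anchor point is the first nonzero entry following an $x$. For each nonzero position $i$, its spacing is the least $d\in\{1,\ldots,n\}$ such that position $i+d$ is an anchor point, and we say $i$ is assigned to that anchor point. The set of spacings associated with an anchor point $a$ is the set of spacings of all nonzero positions assigned to $a$. The anchor point following $a$ is the next anchor point after $a$ in cyclic order. -}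

module Defs where

open import Data.Nat using (ℕ; zero; suc; _+_; _∸_; _≤_; _<_; _⊔_; NonZero)
open import Data.Nat.DivMod using (_mod_)
open import Data.Fin using (Fin; toℕ)
open import Data.List using (List; []; foldr; tabulate)
open import Data.Nat.ListAction using (sum)
open import Data.List.Membership.Propositional using (_∈_)
open import Data.List.Relation.Unary.All using (All)
open import Data.Product using (Σ; ∃; _×_; _,_)
open import Relation.Binary.PropositionalEquality using (_≡_; _≢_)
open import Relation.Nullary using (¬_)
open import Function.Bundles using (_⇔_)
open import Function.Definitions using (Injective)

data Letter : Set where
  𝟎 x y : Letter

data Nonzero : Letter → Set where
  nz-x : Nonzero x
  nz-y : Nonzero y

Word : ℕ → Set
Word n = Fin n → Letter

module _ {n : ℕ} .{{_ : NonZero n}} (w : Word n) where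

  at : ℕ → Letter
  at j = w (j mod n)

  HasX : Set
  HasX = ∃ λ (i : Fin n) → w i ≡ x

  -- position j (read mod n) is an anchor point: w_j nonzero and the nearest
  -- nonzero entry strictly preceding j cyclically (w_{j-d}, least d ∈ {1..n}
  -- with w_{j-d} nonzero) is an x.
  IsAnchor : ℕ → Set
  IsAnchor j = Nonzero (at j) ×
    (∃ λ d → 1 ≤ d × d ≤ n × Nonzero (at (j + n ∸ d)) × at (j + n ∸ d) ≡ x ×
             (∀ e → 1 ≤ e → e < d → ¬ Nonzero (at (j + n ∸ e))))

  Spacing : ℕ → ℕ → Set
  Spacing i d = Nonzero (at i) × 1 ≤ d × d ≤ n × IsAnchor (i + d) ×
    (∀ e → 1 ≤ e → e < d → ¬ IsAnchor (i + e))

  InSpacingSet : Fin n → ℕ → Set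
  InSpacingSet a d = ∃ λ (i : Fin n) → Spacing (toℕ i) d × (toℕ i + d) mod n ≡ a

  NextAnchor : Fin n → Fin n → Set
  NextAnchor a b = ∃ λ e → 1 ≤ e × e ≤ n × IsAnchor (toℕ a + e) ×
    (toℕ a + e) mod n ≡ b × (∀ e' → 1 ≤ e' → e' < e → ¬ IsAnchor (toℕ a + e'))

  -- Finite sets are represented by lists, compared by membership.
  HasSpacingSets : (k : ℕ) → (Fin k → List ℕ) → Set
  HasSpacingSets k S = ∃ λ (a : Fin k → Fin n) →
    Injective _≡_ _≡_ a ×
    (∀ i → IsAnchor (toℕ (a i))) ×
    (∀ (j : Fin n) → IsAnchor (toℕ j) → ∃ λ i → a i ≡ j) ×
    (∀ (i j : Fin k) → toℕ j ≡ suc (toℕ i) → NextAnchor (a i) (a j)) ×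
    (∀ i d → (d ∈ S i ⇔ InSpacingSet (a i) d))

Rotation : {n : ℕ} .{{_ : NonZero n}} → Word n → Word n → Set
Rotation {n} w w' = ∃ λ (r : ℕ) → ∀ (j : Fin n) → w' j ≡ at w (toℕ j + r)

maxList : List ℕ → ℕ
maxList = foldr _⊔_ 0

sumFin : (k : ℕ) → (Fin k → ℕ) → ℕ
sumFin k f = sum (tabulate f)

module Submission where

-- Read backwards from an anchor point, the positions assigned to it are the nonzero
-- entries at the distances in its spacing set: the farthest one is the previous anchor
-- point, and the nearest one is the x that makes it an anchor. Hence consecutive anchor
-- points lie max S(i+1) apart, the nonzero entries are the positions at a distance in
-- S i before the i-th anchor point, and the x's are those at distance min S i. So the
-- word is determined up to rotation, and laying out blocks of lengths max S i in this
-- way produces it.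

open import Defs
open import Data.Empty using (⊥-elim)
open import Data.Fin using (Fin; toℕ; fromℕ<; inject₁) renaming (zero to fzero; suc to fsuc)
open import Data.Fin.Induction using (<-weakInduction)
open import Data.Fin.Properties using (toℕ-injective; toℕ-fromℕ<; toℕ<n; toℕ-inject₁; any?)
open import Data.List using (List; []; _∷_; tabulate)
open import Data.List.Extrema.Nat using (min; argmin-sel; min≤⊤; min≤xs)
open import Data.List.Membership.Propositional using (_∈_)
open import Data.List.Membership.Propositional.Properties using (foldr-selective)
open import Data.List.Properties using (tabulate-cong)
open import Data.List.Relation.Unary.All using (All) renaming (lookup to All-lookup)
open import Data.List.Relation.Unary.Any using (here; there)
open import Data.Nat using (ℕ; zero; suc; _+_; _*_; _∸_; _≤_; _<_; NonZero; z≤n; s≤s; s≤s⁻¹; z<s; _%_; _/_; _≟_; _≤?_; _<?_; >-nonZero⁻¹)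
open import Data.Nat.DivMod
open import Data.List.Membership.DecPropositional _≟_ using (_∈?_)
open import Data.Nat.ListAction using (sum)
open import Data.Nat.Properties
open import Algebra.Properties.CommutativeSemigroup +-commutativeSemigroup using (x∙yz≈y∙xz; x∙yz≈yx∙z)
open import Data.Product using (∃; _×_; _,_; proj₁)
open import Data.Sum using (_⊎_; inj₁; inj₂)
open import Function using (id; _∘_)
open import Function.Bundles using (_⇔_; mk⇔; Equivalence)
open import Function.Definitions using (Injective)
open import Relation.Binary.Definitions using (tri<; tri≈; tri>)
open import Relation.Binary.PropositionalEquality
open import Relation.Nullary using (¬_; Dec; yes; no)

module Modulo (n : ℕ) .{{_ : NonZero n}} where

  infix 4 _≋_
  _≋_ : ℕ → ℕ → Set
  a ≋ b = a % n ≡ b % n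

  %-≋ : ∀ a → a % n ≋ a
  %-≋ a = m%n%n≡m%n a n

  +n-≋ : ∀ a → a + n ≋ a
  +n-≋ a = [m+n]%n≡m%n a n

  +-congʳ-≋ : ∀ {a b} c → a ≋ b → a + c ≋ b + c
  +-congʳ-≋ {a} {b} c a≋b = begin
    (a + c) % n              ≡⟨ %-distribˡ-+ a c n ⟩
    (a % n + c % n) % n      ≡⟨ cong (λ r → (r + c % n) % n) a≋b ⟩
    (b % n + c % n) % n      ≡⟨ %-distribˡ-+ b c n ⟨
    (b + c) % n              ∎
    where open ≡-Reasoning

  +-congˡ-≋ : ∀ {a b} c → a ≋ b → c + a ≋ c + b
  +-congˡ-≋ {a} {b} c a≋b =
    subst₂ _≋_ (+-comm a c) (+-comm b c) (+-congʳ-≋ c a≋b)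

  neg : ℕ → ℕ
  neg c = n ∸ c % n

  +-inverseʳ-≋ : ∀ a c → a + c + neg c ≋ a
  +-inverseʳ-≋ a c = begin
    (a + c + neg c) % n        ≡⟨ cong (_% n) (+-assoc a c (neg c)) ⟩
    (a + (c + neg c)) % n      ≡⟨ cong (λ r → (a + r) % n) c+neg≡ ⟩
    (a + suc (c / n) * n) % n  ≡⟨ [m+kn]%n≡m%n a (suc (c / n)) n ⟩
    a % n                      ∎
    where
    open ≡-Reasoning
    c+neg≡ : c + neg c ≡ suc (c / n) * n
    c+neg≡ = begin
      c + neg c                          ≡⟨ cong (_+ neg c) (m≡m%n+[m/n]*n c n) ⟩
      c % n + c / n * n + neg c          ≡⟨ cong (_+ neg c) (+-comm (c % n) _) ⟩
      c / n * n + c % n + neg c          ≡⟨ +-assoc (c / n * n) (c % n) (neg c) ⟩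
      c / n * n + (c % n + neg c)        ≡⟨ cong (c / n * n +_) (m+[n∸m]≡n (m%n≤n c n)) ⟩
      c / n * n + n                      ≡⟨ +-comm (c / n * n) n ⟩
      suc (c / n) * n                    ∎

  +-cancelʳ-≋ : ∀ a b c → a + c ≋ b + c → a ≋ b
  +-cancelʳ-≋ a b c eq = begin
    a % n                ≡⟨ +-inverseʳ-≋ a c ⟨
    (a + c + neg c) % n  ≡⟨ +-congʳ-≋ (neg c) eq ⟩
    (b + c + neg c) % n  ≡⟨ +-inverseʳ-≋ b c ⟩
    b % n                ∎
    where open ≡-Reasoning

  +-cancelˡ-≋ : ∀ a b c → c + a ≋ c + b → a ≋ b
  +-cancelˡ-≋ a b c eq =
    +-cancelʳ-≋ a b c (subst₂ _≋_ (+-comm c a) (+-comm c b) eq)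

  -- Stepping back by e is written j + n ∸ e in the definitions, to avoid truncation.
  back-cong-≋ : ∀ {q r} e → e ≤ n → q ≋ r → q + n ∸ e ≋ r + n ∸ e
  back-cong-≋ {q} {r} e e≤n q≋r = begin
    (q + n ∸ e) % n    ≡⟨ cong (_% n) (+-∸-assoc q e≤n) ⟩
    (q + (n ∸ e)) % n  ≡⟨ +-congʳ-≋ (n ∸ e) q≋r ⟩
    (r + (n ∸ e)) % n  ≡⟨ cong (_% n) (+-∸-assoc r e≤n) ⟨
    (r + n ∸ e) % n    ∎
    where open ≡-Reasoning

  back-≋ : ∀ {q r} e → e ≤ n → e ≤ r → q ≋ r → q + n ∸ e ≋ r ∸ e
  back-≋ {q} {r} e e≤n e≤r q≋r = begin
    (q + n ∸ e) % n  ≡⟨ back-cong-≋ e e≤n q≋r ⟩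
    (r + n ∸ e) % n  ≡⟨ cong (_% n) (+-∸-comm n e≤r) ⟩
    (r ∸ e + n) % n  ≡⟨ +n-≋ (r ∸ e) ⟩
    (r ∸ e) % n      ∎
    where open ≡-Reasoning

  1≤n : 1 ≤ n
  1≤n = >-nonZero⁻¹ n

  back-+ : ∀ p {d e} → e ≤ n → e ≤ d → p + d + n ∸ e ≋ p + (d ∸ e)
  back-+ p {d} {e} e≤n e≤d =
    trans (back-≋ e e≤n (≤-trans e≤d (m≤n+m d p)) refl) (cong (_% n) (+-∸-assoc p e≤d))

  back-+-self : ∀ p {d} → d ≤ n → p + d + n ∸ d ≋ p
  back-+-self p {d} d≤n = trans (back-+ p d≤n ≤-refl) (cong (_% n) (trans (cong (p +_) (n∸n≡0 d)) (+-identityʳ p)))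

  toℕ-mod : ∀ a → toℕ (a mod n) ≡ a % n
  toℕ-mod a = toℕ-fromℕ< (m%n<n a n)

  toℕ%n≡toℕ : ∀ (i : Fin n) → toℕ i % n ≡ toℕ i
  toℕ%n≡toℕ i = m<n⇒m%n≡m (toℕ<n i)

  mod-≡⇒≋ : ∀ {a} (i : Fin n) → a mod n ≡ i → a ≋ toℕ i
  mod-≡⇒≋ {a} i eq = trans (sym (toℕ-mod a)) (trans (cong toℕ eq) (sym (toℕ%n≡toℕ i)))

  ≋⇒mod-≡ : ∀ {a} (i : Fin n) → a ≋ toℕ i → a mod n ≡ i
  ≋⇒mod-≡ {a} i eq = toℕ-injective (trans (toℕ-mod a) (trans eq (toℕ%n≡toℕ i)))

  mod-cong : ∀ {a b} → a ≋ b → a mod n ≡ b mod n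
  mod-cong {a} {b} eq = ≋⇒mod-≡ (b mod n) (trans eq (mod-≡⇒≋ {b} (b mod n) refl))

Least : (ℕ → Set) → ℕ → Set
Least P d = 1 ≤ d × P d × (∀ e → 1 ≤ e → e < d → ¬ P e)

least-≤ : ∀ {P : ℕ → Set} → (∀ d → Dec (P d)) → ∀ m →
          (∃ λ d → d ≤ m × Least P d) ⊎ (∀ e → 1 ≤ e → e ≤ m → ¬ P e)
least-≤ P? zero = inj₂ λ e 1≤e e≤0 → ⊥-elim (<⇒≱ 1≤e e≤0)
least-≤ {P} P? (suc m) with least-≤ P? m
... | inj₁ (d , d≤m , least) = inj₁ (d , m≤n⇒m≤1+n d≤m , least)
... | inj₂ none with P? (suc m)
...   | yes p = inj₁ (suc m , ≤-refl , s≤s z≤n , p , λ e 1≤e e≤m → none e 1≤e (s≤s⁻¹ e≤m))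
...   | no ¬p = inj₂ none′
  where
  none′ : ∀ e → 1 ≤ e → e ≤ suc m → ¬ P e
  none′ e 1≤e e≤1+m with m≤n⇒m<n∨m≡n e≤1+m
  ... | inj₁ e≤m = none e 1≤e (s≤s⁻¹ e≤m)
  ... | inj₂ refl = ¬p

least : ∀ {P : ℕ → Set} → (∀ d → Dec (P d)) → ∀ {m} → 1 ≤ m → P m → ∃ λ d → d ≤ m × Least P d
least P? {m} 1≤m pm with least-≤ P? m
... | inj₁ found = found
... | inj₂ none = ⊥-elim (none m 1≤m ≤-refl pm)

≤-maxList : ∀ {z T} → z ∈ T → z ≤ maxList T
≤-maxList (here refl) = m≤m⊔n _ _
≤-maxList (there z∈T) = ≤-trans (≤-maxList z∈T) (m≤n⊔m _ _)

maxList-∈ : ∀ {T} → T ≢ [] → maxList T ∈ T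
maxList-∈ {[]} T≢[] = ⊥-elim (T≢[] refl)
maxList-∈ {z ∷ T} _ with foldr-selective ⊔-sel 0 (z ∷ T)
... | inj₂ max∈ = max∈
... | inj₁ max≡0 = here (trans max≡0 (sym (n≤0⇒n≡0 (subst (z ≤_) max≡0 (≤-maxList {T = z ∷ T} (here refl))))))

maxList-≤ : ∀ {e} T → (∀ {z} → z ∈ T → z ≤ e) → maxList T ≤ e
maxList-≤ [] _ = z≤n
maxList-≤ (z ∷ T) bound = ⊔-lub (bound (here refl)) (maxList-≤ T (λ z∈T → bound (there z∈T)))

maxList-unique : ∀ {e T} → e ∈ T → (∀ {z} → z ∈ T → z ≤ e) → maxList T ≡ e
maxList-unique e∈T bound = ≤-antisym (maxList-≤ _ bound) (≤-maxList e∈T)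

minList : List ℕ → ℕ
minList [] = 0
minList (z ∷ T) = min z T

minList-∈ : ∀ {T} → T ≢ [] → minList T ∈ T
minList-∈ {[]} T≢[] = ⊥-elim (T≢[] refl)
minList-∈ {z ∷ T} _ with argmin-sel id z T
... | inj₁ min≡z = here min≡z
... | inj₂ min∈T = there min∈T

minList-≤ : ∀ {z T} → z ∈ T → minList T ≤ z
minList-≤ {T = z ∷ T} (here refl) = min≤⊤ z T
minList-≤ {T = z ∷ T} (there z′∈T) = All-lookup (min≤xs z T) z′∈T

Least-unique : ∀ {P d d′} → Least P d → Least P d′ → d ≡ d′
Least-unique {d = d} {d′} (1≤d , p-d , below) (1≤d′ , p-d′ , below′) with <-cmp d d′
... | tri< d<d′ _ _ = ⊥-elim (below′ d 1≤d d<d′ p-d)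
... | tri≈ _ d≡d′ _ = d≡d′
... | tri> _ _ d′<d = ⊥-elim (below d′ 1≤d′ d′<d p-d′)

nonzero? : ∀ l → Dec (Nonzero l)
nonzero? 𝟎 = no λ ()
nonzero? x = yes nz-x
nonzero? y = yes nz-y

≡x⇒Nonzero : ∀ {l} → l ≡ x → Nonzero l
≡x⇒Nonzero refl = nz-x

𝟎-zero : ¬ Nonzero 𝟎
𝟎-zero ()

Letter-≡ : ∀ {l l′} → (Nonzero l → Nonzero l′) → (Nonzero l′ → Nonzero l) →
           (l ≡ x → l′ ≡ x) → (l′ ≡ x → l ≡ x) → l ≡ l′
Letter-≡ {𝟎} {𝟎} _ _ _ _ = refl
Letter-≡ {x} {x} _ _ _ _ = refl
Letter-≡ {y} {y} _ _ _ _ = refl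
Letter-≡ {𝟎} {x} _ nz′⇒nz _ _ = ⊥-elim (𝟎-zero (nz′⇒nz nz-x))
Letter-≡ {𝟎} {y} _ nz′⇒nz _ _ = ⊥-elim (𝟎-zero (nz′⇒nz nz-y))
Letter-≡ {x} {𝟎} nz⇒nz′ _ _ _ = ⊥-elim (𝟎-zero (nz⇒nz′ nz-x))
Letter-≡ {y} {𝟎} nz⇒nz′ _ _ _ = ⊥-elim (𝟎-zero (nz⇒nz′ nz-y))
Letter-≡ {x} {y} _ _ x⇒x′ _ with x⇒x′ refl
... | ()
Letter-≡ {y} {x} _ _ _ x′⇒x with x′⇒x refl
... | ()

module CyclicWord {n : ℕ} .{{_ : NonZero n}} (w : Word n) where
  open Modulo n

  at-cong : ∀ {a b} → a ≋ b → at w a ≡ at w b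
  at-cong a≋b = cong w (mod-cong a≋b)

  at-toℕ : ∀ (i : Fin n) → at w (toℕ i) ≡ w i
  at-toℕ i = cong w (≋⇒mod-≡ i refl)

  Nonzero-cong : ∀ {a b} → a ≋ b → Nonzero (at w a) → Nonzero (at w b)
  Nonzero-cong a≋b = subst Nonzero (at-cong a≋b)

  IsAnchor-cong : ∀ {j j′} → j ≋ j′ → IsAnchor w j → IsAnchor w j′
  IsAnchor-cong j≋j′ (nz , d , 1≤d , d≤n , nz-d , x-d , between) =
    Nonzero-cong j≋j′ nz , d , 1≤d , d≤n ,
    Nonzero-cong (back-cong-≋ d d≤n j≋j′) nz-d ,
    trans (sym (at-cong (back-cong-≋ d d≤n j≋j′))) x-d ,
    λ e 1≤e e<d → between e 1≤e e<d ∘ Nonzero-cong (back-cong-≋ e (≤-trans (<⇒≤ e<d) d≤n) (sym j≋j′))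

  Spacing-cong : ∀ {i i′} d → i ≋ i′ → Spacing w i d → Spacing w i′ d
  Spacing-cong d i≋i′ (nz , 1≤d , d≤n , anchor , before) =
    Nonzero-cong i≋i′ nz , 1≤d , d≤n , IsAnchor-cong (+-congʳ-≋ d i≋i′) anchor ,
    λ e 1≤e e<d → before e 1≤e e<d ∘ IsAnchor-cong (+-congʳ-≋ e (sym i≋i′))

  anchor-after-x : ∀ {p d} → at w p ≡ x → d ≤ n → Least (λ e → Nonzero (at w (p + e))) d →
                   IsAnchor w (p + d)
  anchor-after-x {p} {d} x-p d≤n (1≤d , nz-d , zero-between) =
    nz-d , d , 1≤d , d≤n , subst Nonzero (sym back-d) (≡x⇒Nonzero x-p) ,
    trans back-d x-p , zero-after
    where
    back-d : at w (p + d + n ∸ d) ≡ at w p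
    back-d = at-cong (back-+-self p d≤n)
    zero-after : ∀ e → 1 ≤ e → e < d → ¬ Nonzero (at w (p + d + n ∸ e))
    zero-after e 1≤e e<d nz-e = zero-between (d ∸ e) (m<n⇒0<n∸m e<d) (∸-monoʳ-< 1≤e (<⇒≤ e<d))
      (Nonzero-cong (back-+ p (≤-trans (<⇒≤ e<d) d≤n) (<⇒≤ e<d)) nz-e)

  next-nonzero : ∀ {p} → Nonzero (at w p) → ∃ λ d → d ≤ n × Least (λ e → Nonzero (at w (p + e))) d
  next-nonzero {p} nz = least (λ e → nonzero? (at w (p + e))) 1≤n (Nonzero-cong (sym (+n-≋ p)) nz)

  x-at-back-distance : ∀ {q d} → IsAnchor w q → Least (λ e → Nonzero (at w (q + n ∸ e))) d →
                       at w (q + n ∸ d) ≡ x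
  x-at-back-distance {q} (_ , d′ , 1≤d′ , _ , nz-d′ , x-d′ , zero-between) least-d =
    subst (λ e → at w (q + n ∸ e) ≡ x) (Least-unique (1≤d′ , nz-d′ , zero-between) least-d) x-d′

  NextAnchor-≋ : ∀ {b b′} (next : NextAnchor w b b′) → toℕ b + proj₁ next ≋ toℕ b′
  NextAnchor-≋ {b′ = b′} (_ , _ , _ , _ , mod≡ , _) = mod-≡⇒≋ b′ mod≡

  -- A spacing d larger than the distance e would put an anchor d ∸ e steps after its position.
  maxList-spacings≡distance : ∀ {b b′ T} → IsAnchor w (toℕ b) → (next : NextAnchor w b b′) →
    (∀ d → d ∈ T ⇔ InSpacingSet w b′ d) → maxList T ≡ proj₁ next
  maxList-spacings≡distance {b} {b′} {T} anchor-b next@(e , 1≤e , e≤n , anchor , mod≡ , before) spacings =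
    maxList-unique (Equivalence.from (spacings e) (b , (proj₁ anchor-b , 1≤e , e≤n , anchor , before) , mod≡))
                   (λ {d} d∈T → spacing≤e (Equivalence.to (spacings d) d∈T))
    where
    spacing≤e : ∀ {d} → InSpacingSet w b′ d → d ≤ e
    spacing≤e {d} (i , (_ , _ , _ , _ , no-earlier) , i+d≡b′) with d ≤? e
    ... | yes d≤e = d≤e
    ... | no d≰e = ⊥-elim (no-earlier (d ∸ e) (m<n⇒0<n∸m e<d) (∸-monoʳ-< 1≤e (<⇒≤ e<d))
                            (IsAnchor-cong (sym middle≋b) anchor-b))
      where
      e<d : e < d
      e<d = ≰⇒> d≰e
      middle≋b : toℕ i + (d ∸ e) ≋ toℕ b
      middle≋b = +-cancelʳ-≋ _ _ e (begin
        (toℕ i + (d ∸ e) + e) % n  ≡⟨ cong (_% n) (trans (+-assoc (toℕ i) _ e) (cong (toℕ i +_) (m∸n+n≡m (<⇒≤ e<d)))) ⟩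
        (toℕ i + d) % n            ≡⟨ mod-≡⇒≋ b′ i+d≡b′ ⟩
        toℕ b′ % n                 ≡⟨ NextAnchor-≋ next ⟨
        (toℕ b + e) % n            ∎)
        where open ≡-Reasoning

  Spacing-unique : ∀ {p d d′} → Spacing w p d → Spacing w p d′ → d ≡ d′
  Spacing-unique (_ , 1≤d , _ , anchor , before) (_ , 1≤d′ , _ , anchor′ , before′) =
    Least-unique (1≤d , anchor , before) (1≤d′ , anchor′ , before′)

  Spacing⇒InSpacingSet : ∀ {p d} (b : Fin n) → Spacing w p d → p + d ≋ toℕ b → InSpacingSet w b d
  Spacing⇒InSpacingSet {p} {d} b spacing p+d≋b =
    p mod n , Spacing-cong d p≋ spacing , ≋⇒mod-≡ b (trans (+-congʳ-≋ d (sym p≋)) p+d≋b)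
    where
    p≋ : p ≋ toℕ (p mod n)
    p≋ = mod-≡⇒≋ (p mod n) refl

module EnumeratedAnchors {n k : ℕ} .{{_ : NonZero n}} (w : Word n) (a : Fin k → Fin n)
  (anchor : ∀ i → IsAnchor w (toℕ (a i))) (onto : ∀ j → IsAnchor w (toℕ j) → ∃ λ i → a i ≡ j) where
  open Modulo n
  open CyclicWord w

  IsAnchor⇒≋ : ∀ {p} → IsAnchor w p → ∃ λ i → p ≋ toℕ (a i)
  IsAnchor⇒≋ {p} anchor-p with onto (p mod n) (IsAnchor-cong (mod-≡⇒≋ (p mod n) refl) anchor-p)
  ... | i , a-i≡ = i , mod-≡⇒≋ (a i) (sym a-i≡)

  ≋⇒IsAnchor : ∀ {p} i → p ≋ toℕ (a i) → IsAnchor w p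
  ≋⇒IsAnchor i p≋ = IsAnchor-cong (sym p≋) (anchor i)

  -- The search is decidable because the anchors are enumerated, and it succeeds
  -- after neg t steps at the latest, at a i₀ itself.
  spacing-of-nonzero : ∀ i₀ t → Nonzero (at w (toℕ (a i₀) + t)) →
    ∃ λ j → ∃ λ d → Spacing w (toℕ (a i₀) + t) d × toℕ (a i₀) + t + d ≋ toℕ (a j)
  spacing-of-nonzero i₀ t nz with least anchor-after? 1≤neg-t (i₀ , +-inverseʳ-≋ (toℕ (a i₀)) t)
    where
    p : ℕ
    p = toℕ (a i₀) + t
    anchor-after? : ∀ d → Dec (∃ λ i → p + d ≋ toℕ (a i))
    anchor-after? d = any? (λ i → (p + d) % n ≟ toℕ (a i) % n)
    1≤neg-t : 1 ≤ neg t
    1≤neg-t = m<n⇒0<n∸m (m%n<n t n)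
  ... | d , d≤neg-t , 1≤d , (j , ≋a-j) , none-before =
    j , d , (nz , 1≤d , ≤-trans d≤neg-t (m∸n≤m n (t % n)) , ≋⇒IsAnchor j ≋a-j ,
             λ e 1≤e e<d → none-before e 1≤e e<d ∘ IsAnchor⇒≋) , ≋a-j

Aligned : ∀ {n k} .{{_ : NonZero n}} → Fin k → (a a′ : Fin k → Fin n) → Set
Aligned {n} i₀ a a′ = ∀ i → ∃ λ c → toℕ (a i) ≋ toℕ (a i₀) + c × toℕ (a′ i) ≋ toℕ (a′ i₀) + c
  where open Modulo n

Aligned-sym : ∀ {n k} .{{_ : NonZero n}} {i₀ : Fin k} {a a′ : Fin k → Fin n} → Aligned i₀ a a′ → Aligned i₀ a′ a
Aligned-sym aligned i with aligned i
... | c , a≋ , a′≋ = c , a′≋ , a≋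

module Transfer {n k : ℕ} .{{_ : NonZero n}} {S : Fin k → List ℕ} {w w′ : Word n} (a a′ : Fin k → Fin n)
  (anchor : ∀ i → IsAnchor w (toℕ (a i))) (onto : ∀ j → IsAnchor w (toℕ j) → ∃ λ i → a i ≡ j)
  (spacings : ∀ i d → d ∈ S i ⇔ InSpacingSet w (a i) d)
  (anchor′ : ∀ i → IsAnchor w′ (toℕ (a′ i))) (spacings′ : ∀ i d → d ∈ S i ⇔ InSpacingSet w′ (a′ i) d)
  (i₀ : Fin k) (aligned : Aligned i₀ a a′) where
  open Modulo n
  open EnumeratedAnchors w a anchor onto

  A A′ : ℕ
  A = toℕ (a i₀)
  A′ = toℕ (a′ i₀)

  ≋-transfer : ∀ t i → A + t ≋ toℕ (a i) → A′ + t ≋ toℕ (a′ i)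
  ≋-transfer t i A+t≋ with aligned i
  ... | c , a≋ , a′≋ = trans (+-congˡ-≋ A′ (+-cancelˡ-≋ t c A (trans A+t≋ a≋))) (sym a′≋)

  anchor-transfer : ∀ t → IsAnchor w (A + t) → IsAnchor w′ (A′ + t)
  anchor-transfer t anchor-t with IsAnchor⇒≋ anchor-t
  ... | i , ≋a-i = CyclicWord.IsAnchor-cong w′ (sym (≋-transfer t i ≋a-i)) (anchor′ i)

  -- A nonzero entry of w has a spacing d ∈ S j to some a j, so w′ has an entry with
  -- spacing d to a′ j, and it sits at the corresponding position.
  nonzero-transfer : ∀ t → Nonzero (at w (A + t)) → Nonzero (at w′ (A′ + t))
  nonzero-transfer t nz = nonzero-before-anchor (spacing-of-nonzero i₀ t nz)
    where
    nonzero-before-anchor : (∃ λ j → ∃ λ d → Spacing w (A + t) d × A + t + d ≋ toℕ (a j)) →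
                            Nonzero (at w′ (A′ + t))
    nonzero-before-anchor (j , d , spacing , ≋a-j) with Equivalence.to (spacings′ j d) (Equivalence.from (spacings j d)
      (CyclicWord.Spacing⇒InSpacingSet w (a j) spacing ≋a-j))
    ... | i′ , spacing′ , i′+d≡ = CyclicWord.Nonzero-cong w′ i′≋ (proj₁ spacing′)
      where
      i′≋ : toℕ i′ ≋ A′ + t
      i′≋ = +-cancelʳ-≋ _ _ d (begin
        (toℕ i′ + d) % n   ≡⟨ mod-≡⇒≋ (a′ j) i′+d≡ ⟩
        toℕ (a′ j) % n     ≡⟨ ≋-transfer (t + d) j (trans (cong (_% n) (sym (+-assoc A t d))) ≋a-j) ⟨
        (A′ + (t + d)) % n ≡⟨ cong (_% n) (+-assoc A′ t d) ⟨
        (A′ + t + d) % n   ∎)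
        where open ≡-Reasoning

-- The next nonzero entry after an x is an anchor; in w′ the corresponding anchor again
-- has its nearest preceding nonzero entry at the position corresponding to the x.
x-transfer : ∀ {n} .{{_ : NonZero n}} {w w′ : Word n} {A A′} →
  (∀ t → Nonzero (at w (A + t)) → Nonzero (at w′ (A′ + t))) →
  (∀ t → Nonzero (at w′ (A′ + t)) → Nonzero (at w (A + t))) →
  (∀ t → IsAnchor w (A + t) → IsAnchor w′ (A′ + t)) →
  ∀ t → at w (A + t) ≡ x → at w′ (A′ + t) ≡ x
x-transfer {n} {w = w} {w′} {A} {A′} nz⇒nz′ nz′⇒nz anchor⇒anchor′ t x-t
  with CyclicWord.next-nonzero w (≡x⇒Nonzero x-t)
... | d , d≤n , least-d@(1≤d , _ , zero-between) =
  trans (sym (at-cong w′ (back-+-self (A′ + t) d≤n))) (x-at-back-distance w′ anchor′-d least-d′)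
  where
  open Modulo n
  open CyclicWord
  anchor′-d : IsAnchor w′ (A′ + t + d)
  anchor′-d = subst (IsAnchor w′) (sym (+-assoc A′ t d))
    (anchor⇒anchor′ (t + d) (subst (IsAnchor w) (+-assoc A t d) (anchor-after-x w x-t d≤n least-d)))
  zero-between′ : ∀ e → 1 ≤ e → e < d → ¬ Nonzero (at w′ (A′ + t + d + n ∸ e))
  zero-between′ e 1≤e e<d nz-e = zero-between (d ∸ e) (m<n⇒0<n∸m e<d) (∸-monoʳ-< 1≤e (<⇒≤ e<d)) nz-w
    where
    nz-w′ : Nonzero (at w′ (A′ + (t + (d ∸ e))))
    nz-w′ = subst Nonzero (cong (at w′) (+-assoc A′ t (d ∸ e)))
      (Nonzero-cong w′ (back-+ (A′ + t) (≤-trans (<⇒≤ e<d) d≤n) (<⇒≤ e<d)) nz-e)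
    nz-w : Nonzero (at w (A + t + (d ∸ e)))
    nz-w = subst Nonzero (cong (at w) (sym (+-assoc A t (d ∸ e)))) (nz′⇒nz (t + (d ∸ e)) nz-w′)
  least-d′ : Least (λ e → Nonzero (at w′ (A′ + t + d + n ∸ e))) d
  least-d′ = 1≤d , Nonzero-cong w′ (sym (back-+-self (A′ + t) d≤n)) (nz⇒nz′ t (≡x⇒Nonzero x-t)) , zero-between′

shifted-≡⇒Rotation : ∀ {n} .{{_ : NonZero n}} {w w′ : Word n} A A′ →
  (∀ t → at w (A + t) ≡ at w′ (A′ + t)) → Rotation w w′
shifted-≡⇒Rotation {n} {w = w} {w′} A A′ same = A + neg A′ , λ j → begin
  w′ j                                ≡⟨ at-toℕ w′ j ⟨
  at w′ (toℕ j)                       ≡⟨ at-cong w′ (sym (A′+[j+neg]≋j j)) ⟩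
  at w′ (A′ + (toℕ j + neg A′))       ≡⟨ same (toℕ j + neg A′) ⟨
  at w (A + (toℕ j + neg A′))         ≡⟨ cong (at w) (x∙yz≈y∙xz A (toℕ j) (neg A′)) ⟩
  at w (toℕ j + (A + neg A′))         ∎
  where
  open Modulo n
  open CyclicWord
  open ≡-Reasoning
  A′+[j+neg]≋j : ∀ (j : Fin n) → A′ + (toℕ j + neg A′) ≋ toℕ j
  A′+[j+neg]≋j j = trans (cong (_% n) (x∙yz≈yx∙z A′ (toℕ j) (neg A′))) (+-inverseʳ-≋ (toℕ j) A′)

module Uniqueness {n k : ℕ} .{{_ : NonZero n}} (S : Fin (suc k) → List ℕ) where
  open Modulo n
  open CyclicWord

  anchor-step : ∀ (w : Word n) {a : Fin (suc k) → Fin n} → (∀ i → IsAnchor w (toℕ (a i))) →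
    (∀ i j → toℕ j ≡ suc (toℕ i) → NextAnchor w (a i) (a j)) →
    (∀ i d → d ∈ S i ⇔ InSpacingSet w (a i) d) →
    ∀ i → toℕ (a (inject₁ i)) + maxList (S (fsuc i)) ≋ toℕ (a (fsuc i))
  anchor-step w {a} anchor next spacings i =
    subst (λ e → toℕ (a (inject₁ i)) + e ≋ toℕ (a (fsuc i)))
          (sym (maxList-spacings≡distance w (anchor (inject₁ i)) next-i (spacings (fsuc i))))
          (NextAnchor-≋ w next-i)
    where
    next-i : NextAnchor w (a (inject₁ i)) (a (fsuc i))
    next-i = next (inject₁ i) (fsuc i) (cong suc (sym (toℕ-inject₁ i)))

  aligned : ∀ {a a′ : Fin (suc k) → Fin n} →
    (∀ i → toℕ (a (inject₁ i)) + maxList (S (fsuc i)) ≋ toℕ (a (fsuc i))) →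
    (∀ i → toℕ (a′ (inject₁ i)) + maxList (S (fsuc i)) ≋ toℕ (a′ (fsuc i))) →
    Aligned fzero a a′
  aligned {a} {a′} step step′ = <-weakInduction _ (0 , base a , base a′) λ i (c , a≋ , a′≋) →
    c + maxList (S (fsuc i)) , extend a c i (step i) a≋ , extend a′ c i (step′ i) a′≋
    where
    base : ∀ b → toℕ (b fzero) ≋ toℕ (b fzero) + 0
    base b = cong (_% n) (sym (+-identityʳ _))
    extend : ∀ b c i → toℕ (b (inject₁ i)) + maxList (S (fsuc i)) ≋ toℕ (b (fsuc i)) →
             toℕ (b (inject₁ i)) ≋ toℕ (b fzero) + c →
             toℕ (b (fsuc i)) ≋ toℕ (b fzero) + (c + maxList (S (fsuc i)))
    extend b c i b-step b≋ = trans (sym b-step)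
      (trans (+-congʳ-≋ (maxList (S (fsuc i))) b≋) (cong (_% n) (+-assoc (toℕ (b fzero)) c _)))

  HasSpacingSets⇒Rotation : ∀ {w w′ : Word n} → HasSpacingSets w (suc k) S → HasSpacingSets w′ (suc k) S →
                            Rotation w w′
  HasSpacingSets⇒Rotation {w} {w′} (a , _ , anchor , onto , next , spacings) (a′ , _ , anchor′ , onto′ , next′ , spacings′) =
    shifted-≡⇒Rotation {w = w} {w′} A A′ λ t →
      Letter-≡ (T.nonzero-transfer t) (T′.nonzero-transfer t) (x⇒x′ t) (x′⇒x t)
    where
    A A′ : ℕ
    A = toℕ (a fzero)
    A′ = toℕ (a′ fzero)
    a≈a′ : Aligned fzero a a′
    a≈a′ = aligned (anchor-step w anchor next spacings) (anchor-step w′ anchor′ next′ spacings′)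
    module T = Transfer {w = w} {w′} a a′ anchor onto spacings anchor′ spacings′ fzero a≈a′
    module T′ = Transfer {w = w′} {w} a′ a anchor′ onto′ spacings′ anchor spacings fzero (Aligned-sym a≈a′)
    x⇒x′ : ∀ t → at w (A + t) ≡ x → at w′ (A′ + t) ≡ x
    x⇒x′ = x-transfer {w = w} {w′} T.nonzero-transfer T′.nonzero-transfer T.anchor-transfer
    x′⇒x : ∀ t → at w′ (A′ + t) ≡ x → at w (A + t) ≡ x
    x′⇒x = x-transfer {w = w′} {w} T′.nonzero-transfer T.nonzero-transfer T′.anchor-transfer

lookupℕ : ∀ {A : Set} {k} → A → (Fin k → A) → ℕ → A
lookupℕ {k = zero} default f m = default
lookupℕ {k = suc k} default f zero = f fzero
lookupℕ {k = suc k} default f (suc m) = lookupℕ default (f ∘ fsuc) m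

lookupℕ-toℕ : ∀ {A : Set} {k} default (f : Fin k → A) i → lookupℕ default f (toℕ i) ≡ f i
lookupℕ-toℕ default f fzero = refl
lookupℕ-toℕ default f (fsuc i) = lookupℕ-toℕ default (f ∘ fsuc) i

partialSum : (ℕ → ℕ) → ℕ → ℕ
partialSum g zero = 0
partialSum g (suc m) = partialSum g m + g m

partialSum-suc : ∀ g m → partialSum g (suc m) ≡ g 0 + partialSum (g ∘ suc) m
partialSum-suc g zero = +-comm 0 (g 0)
partialSum-suc g (suc m) = trans (cong (_+ g (suc m)) (partialSum-suc g m)) (+-assoc (g 0) _ _)

sumFin≡partialSum : ∀ {k} (g : ℕ → ℕ) → sumFin k (g ∘ toℕ) ≡ partialSum g k
sumFin≡partialSum {zero} g = refl
sumFin≡partialSum {suc k} g = trans (cong (g 0 +_) (sumFin≡partialSum {k} (g ∘ suc))) (sym (partialSum-suc g k))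

partialSum-mono-≤ : ∀ g {l l′} → l ≤ l′ → partialSum g l ≤ partialSum g l′
partialSum-mono-≤ g {l} {zero} z≤n = z≤n
partialSum-mono-≤ g {l} {suc l′} l≤1+l′ with m≤n⇒m<n∨m≡n l≤1+l′
... | inj₁ l<1+l′ = ≤-trans (partialSum-mono-≤ g (s≤s⁻¹ l<1+l′)) (m≤m+n _ _)
... | inj₂ refl = ≤-refl

letterFor : List ℕ → ℕ → Letter
letterFor T s with s ∈? T | s ≟ minList T
... | no _ | _ = 𝟎
... | yes _ | yes _ = x
... | yes _ | no _ = y

letterFor-nonzero⇒∈ : ∀ {T s} → Nonzero (letterFor T s) → s ∈ T
letterFor-nonzero⇒∈ {T} {s} nz with s ∈? T | s ≟ minList T
letterFor-nonzero⇒∈ () | no _ | _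
... | yes s∈T | _ = s∈T

∈⇒letterFor-nonzero : ∀ {T s} → s ∈ T → Nonzero (letterFor T s)
∈⇒letterFor-nonzero {T} {s} s∈T with s ∈? T | s ≟ minList T
... | no s∉T | _ = ⊥-elim (s∉T s∈T)
... | yes _ | yes _ = nz-x
... | yes _ | no _ = nz-y

letterFor-x⇒min : ∀ {T s} → letterFor T s ≡ x → s ≡ minList T
letterFor-x⇒min {T} {s} x≡ with s ∈? T | s ≟ minList T
letterFor-x⇒min () | no _ | _
... | yes _ | yes s≡min = s≡min
letterFor-x⇒min () | yes _ | no _

letterFor-min : ∀ {T} → T ≢ [] → letterFor T (minList T) ≡ x
letterFor-min {T} T≢[] with minList T ∈? T | minList T ≟ minList T
... | no min∉T | _ = ⊥-elim (min∉T (minList-∈ T≢[]))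
... | yes _ | yes _ = refl
... | yes _ | no min≢min = ⊥-elim (min≢min refl)

-- The word is the concatenation of k blocks; block m has length max S m, and its
-- entry at distance s from the block's end is nonzero iff s ∈ S m, and is x iff
-- moreover s = min S m. Anchor points are the block starts.
module Existence {n k′ : ℕ} .{{_ : NonZero n}} (S : Fin (suc k′) → List ℕ)
  (nonempty : ∀ i → S i ≢ []) (positive : ∀ i → All (1 ≤_) (S i))
  (total : sumFin (suc k′) (λ i → maxList (S i)) ≡ n) where
  open Modulo n

  k : ℕ
  k = suc k′

  set : ℕ → List ℕ
  set = lookupℕ [] S

  len : ℕ → ℕ
  len m = maxList (set m)

  start end : ℕ → ℕ
  start = partialSum len
  end m = start (suc m)

  set-fromℕ< : ∀ {m} (m<k : m < k) → set m ≡ S (fromℕ< m<k)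
  set-fromℕ< {m} m<k = trans (cong set (sym (toℕ-fromℕ< m<k))) (lookupℕ-toℕ [] S (fromℕ< m<k))

  set-nonempty : ∀ {m} → m < k → set m ≢ []
  set-nonempty m<k set≡[] = nonempty _ (trans (sym (set-fromℕ< m<k)) set≡[])

  set-positive : ∀ {m s} → m < k → s ∈ set m → 1 ≤ s
  set-positive m<k = All-lookup (subst (All (1 ≤_)) (sym (set-fromℕ< m<k)) (positive _))

  len∈set : ∀ {m} → m < k → len m ∈ set m
  len∈set m<k = maxList-∈ (set-nonempty m<k)

  min∈set : ∀ {m} → m < k → minList (set m) ∈ set m
  min∈set m<k = minList-∈ (set-nonempty m<k)

  1≤len : ∀ {m} → m < k → 1 ≤ len m
  1≤len m<k = set-positive m<k (len∈set m<k)

  start-k≡n : start k ≡ n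
  start-k≡n = begin
    partialSum len k                     ≡⟨ sumFin≡partialSum {k} len ⟨
    sum (tabulate {n = k} (len ∘ toℕ))   ≡⟨ cong sum (tabulate-cong (cong maxList ∘ lookupℕ-toℕ [] S)) ⟩
    sum (tabulate (λ i → maxList (S i))) ≡⟨ total ⟩
    n                                    ∎
    where open ≡-Reasoning

  end≤n : ∀ {m} → m < k → end m ≤ n
  end≤n {m} m<k = subst (end m ≤_) start-k≡n (partialSum-mono-≤ len m<k)

  len≤n : ∀ {m} → m < k → len m ≤ n
  len≤n {m} m<k = ≤-trans (m≤n+m (len m) (start m)) (end≤n m<k)

  InBlock : ℕ → ℕ → ℕ → Set
  InBlock p m s = m < k × 1 ≤ s × s ≤ len m × p + s ≡ end m

  InBlock-< : ∀ {p m s} → InBlock p m s → p < end m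
  InBlock-< {p} (_ , 1≤s , _ , p+s≡) = subst (p <_) p+s≡ (m<m+n p 1≤s)

  InBlock-%≡ : ∀ {p m s} → InBlock p m s → p % n ≡ p
  InBlock-%≡ b@(m<k , _) = m<n⇒m%n≡m (<-≤-trans (InBlock-< b) (end≤n m<k))

  InBlock-≥ : ∀ {p m s} → InBlock p m s → start m ≤ p
  InBlock-≥ {p} {m} (_ , _ , s≤len , p+s≡) =
    +-cancelʳ-≤ (len m) (start m) p (subst (_≤ p + len m) p+s≡ (+-monoʳ-≤ p s≤len))

  InBlock-unique : ∀ {p m s m′ s′} → InBlock p m s → InBlock p m′ s′ → m ≡ m′ × s ≡ s′
  InBlock-unique {p} {m} {m′ = m′} b@(_ , _ , _ , p+s≡) b′@(_ , _ , _ , p+s′≡) with <-cmp m m′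
  ... | tri< m<m′ _ _ = ⊥-elim (<⇒≱ (InBlock-< b) (≤-trans (partialSum-mono-≤ len m<m′) (InBlock-≥ b′)))
  ... | tri> _ _ m′<m = ⊥-elim (<⇒≱ (InBlock-< b′) (≤-trans (partialSum-mono-≤ len m′<m) (InBlock-≥ b)))
  ... | tri≈ _ refl _ = refl , +-cancelˡ-≡ p _ _ (trans p+s≡ (sym p+s′≡))

  decompose-below : ∀ p m → m ≤ k → p < start m → ∃ λ m′ → ∃ λ s → InBlock p m′ s
  decompose-below p zero _ ()
  decompose-below p (suc m) 1+m≤k p<end with p <? start m
  ... | yes p<start = decompose-below p m (≤-trans (n≤1+n m) 1+m≤k) p<start
  ... | no p≮start = m , end m ∸ p , 1+m≤k , m<n⇒0<n∸m p<end ,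
        ≤-trans (∸-monoʳ-≤ (end m) (≮⇒≥ p≮start)) (≤-reflexive (m+n∸m≡n (start m) (len m))) ,
        m+[n∸m]≡n (<⇒≤ p<end)

  decompose : ∀ p → p < n → ∃ λ m → ∃ λ s → InBlock p m s
  decompose p p<n = decompose-below p k ≤-refl (subst (p <_) (sym start-k≡n) p<n)

  InBlock-end∸ : ∀ {m e} → m < k → 1 ≤ e → e ≤ len m → InBlock (end m ∸ e) m e
  InBlock-end∸ {m} m<k 1≤e e≤len = m<k , 1≤e , e≤len , m∸n+n≡m (≤-trans e≤len (m≤n+m (len m) (start m)))

  blockLetter : ℕ → ℕ → Letter
  blockLetter m = letterFor (set m)

  opaque
    word : Word n
    word i with decompose (toℕ i) (toℕ<n i)
    ... | m , s , _ = blockLetter m s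

    at-word : ∀ q {m s} → InBlock (q % n) m s → at word q ≡ blockLetter m s
    at-word q {m} {s} b = word-InBlock (q mod n) (toℕ-mod q) b
      where
      word-InBlock : ∀ {p} (i : Fin n) → toℕ i ≡ p → InBlock p m s → word i ≡ blockLetter m s
      word-InBlock i refl b with decompose (toℕ i) (toℕ<n i)
      ... | m′ , s′ , b′ with InBlock-unique b′ b
      ... | refl , refl = refl

  forward : ∀ q {m s e} → InBlock (q % n) m s → e < s → InBlock ((q + e) % n) m (s ∸ e)
  forward q {m} {s} {e} (m<k , _ , s≤len , q+s≡) e<s =
    subst (λ p → InBlock p m (s ∸ e)) (sym q+e%≡)
      (m<k , m<n⇒0<n∸m e<s , ≤-trans (m∸n≤m s e) s≤len ,
       trans (+-assoc (q % n) e _) (trans (cong (q % n +_) (m+[n∸m]≡n (<⇒≤ e<s))) q+s≡))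
    where
    q+e%≡ : (q + e) % n ≡ q % n + e
    q+e%≡ = trans (+-congʳ-≋ e (sym (%-≋ q)))
      (m<n⇒m%n≡m (<-≤-trans (+-monoʳ-< (q % n) e<s) (subst (_≤ n) (sym q+s≡) (end≤n m<k))))

  backward : ∀ q {m s e} → InBlock (q % n) m s → s + e ≤ len m → InBlock ((q + n ∸ e) % n) m (s + e)
  backward q {m} {s} {e} b@(m<k , 1≤s , _ , q+s≡) s+e≤len =
    subst (λ p → InBlock p m (s + e)) (sym q-e%≡)
      (m<k , ≤-trans 1≤s (m≤m+n s e) , s+e≤len ,
       trans (cong (q % n ∸ e +_) (+-comm s e)) (trans (sym (+-assoc _ e s)) (trans (cong (_+ s) (m∸n+n≡m e≤q)) q+s≡)))
    where
    e≤q : e ≤ q % n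
    e≤q = +-cancelʳ-≤ s e (q % n)
      (≤-trans (≤-reflexive (+-comm e s)) (≤-trans s+e≤len (subst (len m ≤_) (sym q+s≡) (m≤n+m (len m) (start m)))))
    q-e%≡ : (q + n ∸ e) % n ≡ q % n ∸ e
    q-e%≡ = trans (back-≋ e (≤-trans (≤-trans (m≤n+m e s) s+e≤len) (len≤n m<k)) e≤q (sym (%-≋ q)))
      (m<n⇒m%n≡m (≤-<-trans (m∸n≤m (q % n) e) (m%n<n q n)))

  InBlock-+-≋-end : ∀ q {m s} → InBlock (q % n) m s → q + s ≋ end m
  InBlock-+-≋-end q {s = s} (_ , _ , _ , q+s≡) = trans (+-congʳ-≋ s (sym (%-≋ q))) (cong (_% n) q+s≡)

  start-of-next : ∀ {m} → m < k → ∃ λ m′ → InBlock (end m % n) m′ (len m′)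
  start-of-next {m} m<k with suc m <? k
  ... | yes 1+m<k = suc m , subst (λ p → InBlock p (suc m) (len (suc m))) (sym (m<n⇒m%n≡m end<n))
                              (1+m<k , 1≤len 1+m<k , ≤-refl , refl)
    where
    end<n : end m < n
    end<n = <-≤-trans (m<m+n (end m) (1≤len 1+m<k)) (end≤n 1+m<k)
  ... | no 1+m≮k = 0 , subst (λ p → InBlock p 0 (len 0)) (sym end%≡0) (z<s , 1≤len z<s , ≤-refl , refl)
    where
    end%≡0 : end m % n ≡ 0
    end%≡0 = trans (cong (λ l → end l % n) (≤-antisym (s≤s⁻¹ m<k) (s≤s⁻¹ (≮⇒≥ 1+m≮k))))
                   (trans (cong (_% n) start-k≡n) (n%n≡0 n))

  back-from-end : ∀ q {m e} → m < k → q ≋ end m → 1 ≤ e → e ≤ len m → at word (q + n ∸ e) ≡ blockLetter m e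
  back-from-end q {m} {e} m<k q≋end 1≤e e≤len = at-word (q + n ∸ e) (subst (λ p → InBlock p m e) (sym q-e%≡) b)
    where
    b : InBlock (end m ∸ e) m e
    b = InBlock-end∸ m<k 1≤e e≤len
    q-e%≡ : (q + n ∸ e) % n ≡ end m ∸ e
    q-e%≡ = trans (back-≋ e (≤-trans e≤len (len≤n m<k)) (≤-trans e≤len (m≤n+m (len m) (start m))) q≋end)
                  (InBlock-%≡ b)

  end-anchor : ∀ q {m} → m < k → q ≋ end m → IsAnchor word q
  end-anchor q {m} m<k q≋end with start-of-next m<k
  ... | m′ , b = nz-q , μ , 1≤μ , ≤-trans μ≤len (len≤n m<k) ,
                 ≡x⇒Nonzero x-back , x-back , zero-between
    where
    μ : ℕ
    μ = minList (set m)
    1≤μ : 1 ≤ μ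
    1≤μ = set-positive m<k (min∈set m<k)
    μ≤len : μ ≤ len m
    μ≤len = ≤-maxList (min∈set m<k)
    nz-q : Nonzero (at word q)
    nz-q = subst Nonzero (sym (at-word q (subst (λ p → InBlock p m′ (len m′)) (sym q≋end) b)))
                 (∈⇒letterFor-nonzero (len∈set (proj₁ b)))
    x-back : at word (q + n ∸ μ) ≡ x
    x-back = trans (back-from-end q m<k q≋end 1≤μ μ≤len) (letterFor-min (set-nonempty m<k))
    zero-between : ∀ e → 1 ≤ e → e < μ → ¬ Nonzero (at word (q + n ∸ e))
    zero-between e 1≤e e<μ nz-e = <⇒≱ e<μ (minList-≤ (letterFor-nonzero⇒∈
      (subst Nonzero (back-from-end q m<k q≋end 1≤e (≤-trans (<⇒≤ e<μ) μ≤len)) nz-e)))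

  -- If s < len m, the nearest nonzero entry before q still lies in block m (the entry at
  -- distance len m is nonzero), so it is x only at distance min S m ≤ s: impossible.
  anchor⇒full : ∀ q {m s} → IsAnchor word q → InBlock (q % n) m s → s ≡ len m
  anchor⇒full q {m} {s} (nz-q , d , 1≤d , d≤n , nz-d , x-d , zero-between) b@(_ , _ , s≤len , _)
    with s ≟ len m | d ≤? len m ∸ s
  ... | yes s≡len | _ = s≡len
  ... | no _ | yes d≤gap =
    ⊥-elim (<⇒≱ (m<m+n s 1≤d) (subst (_≤ s) (sym s+d≡μ) (minList-≤ s∈set)))
    where
    s∈set : s ∈ set m
    s∈set = letterFor-nonzero⇒∈ (subst Nonzero (at-word q b) nz-q)
    s+d≡μ : s + d ≡ minList (set m)
    s+d≡μ = letterFor-x⇒min (trans (sym (at-word _ (backward q b (≤-trans (+-monoʳ-≤ s d≤gap) (≤-reflexive (m+[n∸m]≡n s≤len)))))) x-d)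
  ... | no s≢len | no d≰gap = ⊥-elim (zero-between gap 1≤gap (≰⇒> d≰gap) nz-gap)
    where
    gap : ℕ
    gap = len m ∸ s
    1≤gap : 1 ≤ gap
    1≤gap = m<n⇒0<n∸m (≤∧≢⇒< s≤len s≢len)
    s+gap≡len : s + gap ≡ len m
    s+gap≡len = m+[n∸m]≡n s≤len
    nz-gap : Nonzero (at word (q + n ∸ gap))
    nz-gap = subst Nonzero (sym (at-word _ (backward q b (≤-reflexive s+gap≡len))))
                   (∈⇒letterFor-nonzero (subst (_∈ set m) (sym s+gap≡len) (maxList-∈ (set-nonempty (proj₁ b)))))

  full⇒≋end : ∀ q {m} → InBlock (q % n) m (len m) → ∃ λ m′ → m′ < k × q ≋ end m′
  full⇒≋end q {zero} (_ , _ , _ , q+len≡) =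
    k′ , ≤-refl , trans (+-cancelʳ-≡ (len 0) (q % n) 0 q+len≡) (sym (trans (cong (_% n) start-k≡n) (n%n≡0 n)))
  full⇒≋end q {suc m} (1+m<k , _ , _ , q+len≡) =
    m , <-trans (n<1+n m) 1+m<k , trans (sym (%-≋ q)) (cong (_% n) (+-cancelʳ-≡ (len (suc m)) (q % n) (end m) q+len≡))

  InBlock⇒Spacing : ∀ q {m s} → InBlock (q % n) m s → Nonzero (at word q) → Spacing word q s
  InBlock⇒Spacing q {s = s} b@(m<k , 1≤s , s≤len , _) nz =
    nz , 1≤s , ≤-trans s≤len (len≤n m<k) , end-anchor (q + s) m<k (InBlock-+-≋-end q b) ,
    λ e 1≤e e<s anchor → <⇒≢ (<-≤-trans (∸-monoʳ-< 1≤e (<⇒≤ e<s)) s≤len) (anchor⇒full (q + e) anchor (forward q b e<s))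

  end-injective : ∀ {m m′} → m < k → m′ < k → end m ≋ end m′ → m ≡ m′
  end-injective {m} {m′} m<k m′<k end≋end = proj₁ (InBlock-unique b (subst (λ p → InBlock p m′ 1) (sym before≡) b′))
    where
    b : InBlock (end m ∸ 1) m 1
    b = InBlock-end∸ m<k ≤-refl (1≤len m<k)
    b′ : InBlock (end m′ ∸ 1) m′ 1
    b′ = InBlock-end∸ m′<k ≤-refl (1≤len m′<k)
    1≤end : ∀ {l} → l < k → 1 ≤ end l
    1≤end {l} l<k = ≤-trans (1≤len l<k) (m≤n+m (len l) (start l))
    before≡ : end m ∸ 1 ≡ end m′ ∸ 1
    before≡ = trans (sym (InBlock-%≡ b)) (trans (+-cancelʳ-≋ _ _ 1
      (subst₂ _≋_ (sym (m∸n+n≡m (1≤end m<k))) (sym (m∸n+n≡m (1≤end m′<k))) end≋end)) (InBlock-%≡ b′))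

  anchors : Fin k → Fin n
  anchors i = end (toℕ i) mod n

  anchors-≋ : ∀ i → toℕ (anchors i) ≋ end (toℕ i)
  anchors-≋ i = sym (mod-≡⇒≋ (anchors i) refl)

  anchor-anchors : ∀ i → IsAnchor word (toℕ (anchors i))
  anchor-anchors i = end-anchor _ (toℕ<n i) (anchors-≋ i)

  anchors-injective : Injective _≡_ _≡_ anchors
  anchors-injective {i} {j} a≡a = toℕ-injective (end-injective (toℕ<n i) (toℕ<n j)
    (trans (sym (anchors-≋ i)) (trans (cong (λ b → toℕ b % n) a≡a) (anchors-≋ j))))

  anchors-onto : ∀ j → IsAnchor word (toℕ j) → ∃ λ i → anchors i ≡ j
  anchors-onto j anchor with decompose (toℕ j % n) (m%n<n _ n)
  ... | m , s , b with full⇒≋end (toℕ j) (subst (InBlock (toℕ j % n) m) (anchor⇒full (toℕ j) anchor b) b)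
  ... | m′ , m′<k , j≋end = fromℕ< m′<k ,
        ≋⇒mod-≡ j (trans (cong (λ l → end l % n) (toℕ-fromℕ< m′<k)) (sym j≋end))

  anchors-next : ∀ i j → toℕ j ≡ suc (toℕ i) → NextAnchor word (anchors i) (anchors j)
  anchors-next i j j≡1+i = len (toℕ j) , 1≤len j<k , len≤n j<k , end-anchor _ j<k a+len≋ ,
                           ≋⇒mod-≡ (anchors j) (trans a+len≋ (sym (anchors-≋ j))) , no-anchor-before
    where
    j<k : toℕ j < k
    j<k = toℕ<n j
    1+i<k : suc (toℕ i) < k
    1+i<k = subst (_< k) j≡1+i j<k
    a+len≋ : toℕ (anchors i) + len (toℕ j) ≋ end (toℕ j)
    a+len≋ = subst (λ l → toℕ (anchors i) + len l ≋ end l) (sym j≡1+i)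
                   (+-congʳ-≋ (len (suc (toℕ i))) (anchors-≋ i))
    block-j : InBlock (end (toℕ i)) (toℕ j) (len (toℕ j))
    block-j = subst (λ l → InBlock (end (toℕ i)) l (len l)) (sym j≡1+i) (1+i<k , 1≤len 1+i<k , ≤-refl , refl)
    next-block : InBlock (toℕ (anchors i) % n) (toℕ j) (len (toℕ j))
    next-block = subst (λ p → InBlock p (toℕ j) (len (toℕ j))) (sym (trans (anchors-≋ i) (InBlock-%≡ block-j))) block-j
    no-anchor-before : ∀ e → 1 ≤ e → e < len (toℕ j) → ¬ IsAnchor word (toℕ (anchors i) + e)
    no-anchor-before e 1≤e e<len anchor = <⇒≢ (∸-monoʳ-< 1≤e (<⇒≤ e<len))
      (anchor⇒full _ anchor (forward (toℕ (anchors i)) next-block e<len))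

  anchors-spacings : ∀ i d → d ∈ S i ⇔ InSpacingSet word (anchors i) d
  anchors-spacings i d = mk⇔ to from
    where
    set≡S : set (toℕ i) ≡ S i
    set≡S = lookupℕ-toℕ [] S i
    to : d ∈ S i → InSpacingSet word (anchors i) d
    to d∈S = CyclicWord.Spacing⇒InSpacingSet word (anchors i)
               (InBlock⇒Spacing p b′ (subst Nonzero (sym (at-word p b′)) (∈⇒letterFor-nonzero d∈set)))
               (trans (InBlock-+-≋-end p b′) (sym (anchors-≋ i)))
      where
      d∈set : d ∈ set (toℕ i)
      d∈set = subst (d ∈_) (sym set≡S) d∈S
      p : ℕ
      p = end (toℕ i) ∸ d
      b : InBlock p (toℕ i) d
      b = InBlock-end∸ (toℕ<n i) (set-positive (toℕ<n i) d∈set) (≤-maxList d∈set)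
      b′ : InBlock (p % n) (toℕ i) d
      b′ = subst (λ q → InBlock q (toℕ i) d) (sym (InBlock-%≡ b)) b
    from : InSpacingSet word (anchors i) d → d ∈ S i
    from (i′ , spacing , i′+d≡) with decompose (toℕ i′ % n) (m%n<n _ n)
    ... | m , s , b = subst (d ∈_) set≡S (subst₂ (λ l e → e ∈ set l) m≡i (sym d≡s) s∈set)
      where
      d≡s : d ≡ s
      d≡s = CyclicWord.Spacing-unique word spacing (InBlock⇒Spacing (toℕ i′) b (proj₁ spacing))
      s∈set : s ∈ set m
      s∈set = letterFor-nonzero⇒∈ (subst Nonzero (at-word (toℕ i′) b) (proj₁ spacing))
      m≡i : m ≡ toℕ i
      m≡i = end-injective (proj₁ b) (toℕ<n i) (begin
        end m % n              ≡⟨ InBlock-+-≋-end (toℕ i′) b ⟨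
        (toℕ i′ + s) % n       ≡⟨ cong (λ e → (toℕ i′ + e) % n) d≡s ⟨
        (toℕ i′ + d) % n       ≡⟨ mod-≡⇒≋ (anchors i) i′+d≡ ⟩
        toℕ (anchors i) % n    ≡⟨ anchors-≋ i ⟩
        end (toℕ i) % n        ∎)
        where open ≡-Reasoning

  word-hasX : HasX word
  word-hasX = p mod n , trans (at-word p b′) (letterFor-min (set-nonempty z<s))
    where
    p : ℕ
    p = end 0 ∸ minList (set 0)
    b : InBlock p 0 (minList (set 0))
    b = InBlock-end∸ z<s (set-positive z<s (min∈set z<s)) (≤-maxList (min∈set z<s))
    b′ : InBlock (p % n) 0 (minList (set 0))
    b′ = subst (λ q → InBlock q 0 (minList (set 0))) (sym (InBlock-%≡ b)) b

  word-HasSpacingSets : HasSpacingSets word k S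
  word-HasSpacingSets = anchors , anchors-injective , anchor-anchors , anchors-onto , anchors-next , anchors-spacings

lemma2p3 : (n k : ℕ) .{{_ : NonZero n}} → 1 ≤ k → (S : Fin k → List ℕ) →
    (∀ i → S i ≢ []) → (∀ i → All (1 ≤_) (S i)) →
    sumFin k (λ i → maxList (S i)) ≡ n →
    (∃ λ (w : Word n) → HasX w × HasSpacingSets w k S) ×
    (∀ (w w' : Word n) → HasX w → HasSpacingSets w k S →
       HasX w' → HasSpacingSets w' k S → Rotation w w')
lemma2p3 n (suc k′) _ S nonempty positive total =
  (word , word-hasX , word-HasSpacingSets) ,
  λ w w′ _ hs _ hs′ → Uniqueness.HasSpacingSets⇒Rotation S {w} {w′} hs hs′
  where open Existence S nonempty positive total
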